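{- In the setting below, the points $s=-N/2$ and $s=1-N/2$ are both critical for $L(s,\sigma\times\sigma'^{\mathsf v})$ if and only if $$-\tfrac N2+1-\tfrac{\ell(\mu,\mu')}{2}\ \le\ a(\mu,\mu')\ \le\ -\tfrac N2-1+\tfrac{\ell(\mu,\mu')}{2}.$$
   Context: $F$ is a totally imaginary number field; $n,n'\ge1$, $N=n+n'$; $\mu=(\mu^\eta)_{\eta\in\mathrm{Hom}(F,\mathbb{C})}$ with $\mu^\eta=(b^\eta_1\ge\cdots\ge b^\eta_n)$ and $\mu'$ with $\mu'^\eta=(b'^\eta_1\ge\cdots\ge b'^\eta_{n'})$ are strongly-pure integral weights (i.e. there is $\mathsf w$ with $b^{\varsigma^{ -1}\eta}_j+b^{\varsigma^{ -1}\bar\eta}_{n-j+1}=\mathsf w$ for all $\eta,j$ and all $\varsigma\in\mathrm{Aut}(\mathbb{C})$, similarly $\mathsf w'$ for $\mu'$); $\sigma,\sigma'$ are cuspidal automorphic representations of $\mathrm{GL}_n(\mathbb{A}_F)$, $\mathrm{GL}_{n'}(\mathbb{A}_F)$ cohomological with respect to $\mu,\mu'$. For each archimedean place $v$ fix $\eta_v$ among its two conjugate embeddings; cuspidal parameters: $\alpha^v_i=-b^{\eta_v}_{n-i+1}+\frac{n-2i+1}{2}$, $\beta^v_i=-b^{\bar\eta_v}_i-\frac{n-2i+1}{2}$, and likewise $\alpha'^v_j,\beta'^v_j$. Abelian width $a(\mu,\mu')=(\mathsf w-\mathsf w')/2$; cuspidal width $\ell(\mu,\mu')=\min_{v,i,j}|\alpha^v_i-\alpha'^v_j-\beta^v_i+\beta'^v_j|$.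 A point $m\in\frac N2+\mathbb{Z}$ is critical for $L(s,\sigma\times\sigma'^{\mathsf v})$ if both $L_\infty(s,\sigma\times\sigma'^{\mathsf v})=\prod_{v,i,j}L(s,z^{\alpha^v_i-\alpha'^v_j}\bar z^{\beta^v_i-\beta'^v_j})$ and $L_\infty(1-s,\sigma^{\mathsf v}\times\sigma')=\prod_{v,i,j}L(1-s,z^{ -\alpha^v_i+\alpha'^v_j}\bar z^{ -\beta^v_i+\beta'^v_j})$ are finite at $s=m$, where $L(s,z^a\bar z^b)=2(2\pi)^{ -(s+\frac{a+b}{2}+\frac{|a-b|}2)}\Gamma(s+\frac{a+b}2+\frac{|a-b|}2)$. -}

module Defs where

open import Data.Nat using (ℕ; suc)
open import Data.Integer as ℤ using (ℤ; +_)
open import Data.Rational using (ℚ; _+_; _-_; -_; _*_; _≤_; ∣_∣; _⊓_; ½; 1ℚ; _/_)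
open import Data.Fin as Fin using (Fin; zero; suc; toℕ; opposite)
open import Data.Bool using (Bool; true; false; not)
open import Data.Product using (_×_; Σ)
open import Relation.Binary.PropositionalEquality using (_≡_; _≢_)

-- Embeddings of a totally imaginary field F with r archimedean places:
-- an embedding is a pair (v , e) with v : Fin r a place and e : Bool;
-- (v , true) is the fixed embedding η_v, (v , false) its conjugate η̄_v.

-- A family of (integral) weights μ = (μ^η)_η, μ^η = (b^η_1 , … , b^η_n);
-- Fin n index k stands for the subscript k+1.
Weight : ℕ → ℕ → Set
Weight r n = Fin r → Bool → Fin n → ℤ

Dominant : ∀ {r n} → Weight r n → Set
Dominant {r} {n} b = (v : Fin r) (e : Bool) (i j : Fin n) → i Fin.≤ j → b v e j ℤ.≤ b v e i

-- purity with weight w: b^η_j + b^{η̄}_{n-j+1} = w for every embedding η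
-- (this is the ς = id instance of strong purity)
Pure : ∀ {r n} → Weight r n → ℤ → Set
Pure {r} {n} b w = (v : Fin r) (e : Bool) (j : Fin n) → b v e j ℤ.+ b v (not e) (opposite j) ≡ w

ℤ→ℚ : ℤ → ℚ
ℤ→ℚ z = z / 1

ℕ→ℚ : ℕ → ℚ
ℕ→ℚ k = (+ k) / 1

-- (n - 2i + 1)/2 for the subscript i = toℕ k + 1
shift : (n : ℕ) → Fin n → ℚ
shift n k = ½ * (ℕ→ℚ n - ℕ→ℚ 2 * ℕ→ℚ (suc (toℕ k)) + 1ℚ)

α : ∀ {r n} → Weight r n → Fin r → Fin n → ℚ
α {r} {n} b v i = - ℤ→ℚ (b v true (opposite i)) + shift n i

β : ∀ {r n} → Weight r n → Fin r → Fin n → ℚ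
β {r} {n} b v i = - ℤ→ℚ (b v false i) - shift n i

minFin : ∀ {k} → (Fin (suc k) → ℚ) → ℚ
minFin {ℕ.zero} f = f zero
minFin {suc k} f = f zero ⊓ minFin (λ i → f (suc i))

abelianWidth : ℤ → ℤ → ℚ
abelianWidth w w' = ½ * (ℤ→ℚ w - ℤ→ℚ w')

cuspidalWidth : ∀ {r n n'} → Weight (suc r) (suc n) → Weight (suc r) (suc n') → ℚ
cuspidalWidth b b' =
  minFin (λ v → minFin (λ i → minFin (λ j →
    ∣ α b v i - α b' v j - β b v i + β b' v j ∣)))

-- Γ(x) is finite (x is not a pole of Γ) iff x ∉ {0, -1, -2, …}
GammaFinite : ℚ → Set
GammaFinite x = (k : ℕ) → x ≢ - ℕ→ℚ k

-- L(s, z^a z̄^b) = 2(2π)^{-(s + (a+b)/2 + |a-b|/2)} Γ(s + (a+b)/2 + |a-b|/2);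
-- the exponential factor is always finite, so L is finite at s iff Γ is.
LFinite : ℚ → ℚ → ℚ → Set
LFinite s a b = GammaFinite (s + ½ * (a + b) + ½ * ∣ a - b ∣)

-- s = m is critical for L(s, σ × σ'^v): both archimedean L-factors
-- L_∞(s, σ×σ'^v) and L_∞(1-s, σ^v×σ') are finite at s = m
-- (a finite product of finite values is finite).
Critical : ∀ {r n n'} → Weight r n → Weight r n' → ℚ → Set
Critical {r} {n} {n'} b b' m =
  ((v : Fin r) (i : Fin n) (j : Fin n') →
     LFinite m (α b v i - α b' v j) (β b v i - β b' v j))
  × ((v : Fin r) (i : Fin n) (j : Fin n') →
     LFinite (1ℚ - m) (- α b v i + α b' v j) (- β b v i + β b' v j))

module Submission where

-- Purity gives α_i + β_i = -w, so the exponents p = α_i - α'_j and q = β_i - β'_j of each Γ-factor of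
-- L_∞(s, σ × σ'^v) satisfy ½(p + q) = -a(μ,μ'), while |p - q| is the quantity whose minimum is ℓ(μ,μ').
-- The Γ-argument s + ½(p + q) + ½|p - q| = s + max(p, q) is an integer for s ∈ -N/2 + ℤ, so that factor is
-- finite iff s - a + ½|p - q| ≥ 1, and the factor of L_∞(1 - s, σ^v × σ') iff 1 - s + a + ½|p - q| ≥ 1.
-- Over all factors |p - q| may be replaced by its minimum ℓ; at s = -N/2 and s = 1 - N/2 two of the four
-- resulting inequalities are the bounds on a, and the other two are weaker by 1.

open import Data.Nat as ℕ using (ℕ; suc)
open import Data.Integer as ℤ using (ℤ; +_; -[1+_])
open import Data.Integer.Tactic.RingSolver using (solve-∀)
open import Data.Rational
open import Data.Rational.Properties
import Data.Rational.Unnormalised as ℚᵘ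
import Data.Rational.Unnormalised.Properties as ℚᵘ
open import Data.Nat.Coprimality using (1-coprimeTo) renaming (sym to coprime-sym)
open import Relation.Binary.PropositionalEquality
  using (_≡_; refl; sym; trans; cong; cong₂; subst; subst₂; module ≡-Reasoning)
open import Data.Product using (∃-syntax; _,_; _×_; proj₁; proj₂)
open import Data.Product.Function.NonDependent.Propositional using (_×-⇔_)
open import Function.Construct.Composition using (_⇔-∘_)
open import Data.Sum using (inj₁; inj₂)
open import Data.Empty using (⊥; ⊥-elim)
open import Data.Rational.Solver using (module +-*-Solver)
open +-*-Solver
open import Data.Fin using (Fin; zero; suc; toℕ; opposite)
open import Data.Fin.Properties using (opposite-involutive)
open import Data.Bool using (true; false)
open import Relation.Binary.Definitions using (_Respects_)
open import Function.Bundles using (_⇔_; mk⇔; Equivalence)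
open import Function.Base using (_∘_)
open import Defs

ℤ→ℚ-canonical : ∀ z → ℤ→ℚ z ≡ mkℚ z 0 (coprime-sym (1-coprimeTo ℤ.∣ z ∣))
ℤ→ℚ-canonical z = ↥p/↧p≡p _

ℤ→ℚ-+ : ∀ x y → ℤ→ℚ (x ℤ.+ y) ≡ ℤ→ℚ x + ℤ→ℚ y
ℤ→ℚ-+ x y = toℚᵘ-injective (begin
  toℚᵘ (ℤ→ℚ (x ℤ.+ y))
    ≈⟨ toℚᵘ-fromℚᵘ (ℚᵘ.mkℚᵘ (x ℤ.+ y) 0) ⟩
  ℚᵘ.mkℚᵘ (x ℤ.+ y) 0
    ≈⟨ ℚᵘ.*≡* (cross-multiplied x y) ⟩
  ℚᵘ.mkℚᵘ x 0 ℚᵘ.+ ℚᵘ.mkℚᵘ y 0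
    ≈⟨ ℚᵘ.≃-sym (ℚᵘ.+-cong (toℚᵘ-fromℚᵘ (ℚᵘ.mkℚᵘ x 0)) (toℚᵘ-fromℚᵘ (ℚᵘ.mkℚᵘ y 0))) ⟩
  toℚᵘ (ℤ→ℚ x) ℚᵘ.+ toℚᵘ (ℤ→ℚ y)
    ≈⟨ ℚᵘ.≃-sym (toℚᵘ-homo-+ (ℤ→ℚ x) (ℤ→ℚ y)) ⟩
  toℚᵘ (ℤ→ℚ x + ℤ→ℚ y)
    ∎)
  where
  open ℚᵘ.≃-Reasoning
  cross-multiplied : ∀ x y → (x ℤ.+ y) ℤ.* + 1 ≡ (x ℤ.* + 1 ℤ.+ y ℤ.* + 1) ℤ.* + 1
  cross-multiplied = solve-∀

ℤ→ℚ-neg : ∀ x → ℤ→ℚ (ℤ.- x) ≡ - ℤ→ℚ x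
ℤ→ℚ-neg x = toℚᵘ-injective (begin
  toℚᵘ (ℤ→ℚ (ℤ.- x))      ≈⟨ toℚᵘ-fromℚᵘ (ℚᵘ.mkℚᵘ (ℤ.- x) 0) ⟩
  ℚᵘ.- ℚᵘ.mkℚᵘ x 0         ≈⟨ ℚᵘ.-‿cong (ℚᵘ.≃-sym (toℚᵘ-fromℚᵘ (ℚᵘ.mkℚᵘ x 0))) ⟩
  ℚᵘ.- toℚᵘ (ℤ→ℚ x)       ≈⟨ ℚᵘ.≃-sym (toℚᵘ-homo‿- (ℤ→ℚ x)) ⟩
  toℚᵘ (- ℤ→ℚ x)           ∎)
  where open ℚᵘ.≃-Reasoning

ℕ→ℚ-+ : ∀ m n → ℕ→ℚ (m ℕ.+ n) ≡ ℕ→ℚ m + ℕ→ℚ n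
ℕ→ℚ-+ m n = ℤ→ℚ-+ (+ m) (+ n)

Integral : ℚ → Set
Integral x = ∃[ z ] x ≡ ℤ→ℚ z

ℤ→ℚ-integral : ∀ z → Integral (ℤ→ℚ z)
ℤ→ℚ-integral z = z , refl

ℕ→ℚ-integral : ∀ k → Integral (ℕ→ℚ k)
ℕ→ℚ-integral k = ℤ→ℚ-integral (+ k)

integral-+ : ∀ {x y} → Integral x → Integral y → Integral (x + y)
integral-+ (z , refl) (z' , refl) = z ℤ.+ z' , sym (ℤ→ℚ-+ z z')

integral-neg : ∀ {x} → Integral x → Integral (- x)
integral-neg (z , refl) = ℤ.- z , sym (ℤ→ℚ-neg z)

integral-- : ∀ {x y} → Integral x → Integral y → Integral (x - y)
integral-- ix iy = integral-+ ix (integral-neg iy)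

integral-⊔ : ∀ {x y} → Integral x → Integral y → Integral (x ⊔ y)
integral-⊔ {x} {y} ix iy with ⊔-sel x y
... | inj₁ x⊔y≡x = subst Integral (sym x⊔y≡x) ix
... | inj₂ x⊔y≡y = subst Integral (sym x⊔y≡y) iy

gammaFinite⇔ : ∀ {x} → Integral x → GammaFinite x ⇔ (1ℚ ≤ x)
gammaFinite⇔ {x} (z , refl) = mk⇔ (finite⇒positive z) positive⇒finite
  where
  finite⇒positive : ∀ z → GammaFinite (ℤ→ℚ z) → 1ℚ ≤ ℤ→ℚ z
  finite⇒positive (+ 0)      finite = ⊥-elim (finite 0 refl)
  finite⇒positive -[1+ k ]   finite = ⊥-elim (finite (suc k) refl)
  finite⇒positive (+ suc k)  _ rewrite ℤ→ℚ-canonical (+ suc k) = *≤* (ℤ.+≤+ (ℕ.s≤s ℕ.z≤n))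

  1≰-ℕ→ℚ : ∀ k → 1ℚ ≤ - ℕ→ℚ k → ⊥
  1≰-ℕ→ℚ k 1≤-k with subst (λ t → 1ℚ ≤ - t) (ℤ→ℚ-canonical (+ k)) 1≤-k
  1≰-ℕ→ℚ 0       _ | *≤* (ℤ.+≤+ ())
  1≰-ℕ→ℚ (suc k) _ | *≤* ()

  positive⇒finite : 1ℚ ≤ ℤ→ℚ z → GammaFinite (ℤ→ℚ z)
  positive⇒finite 1≤z k z≡-k = 1≰-ℕ→ℚ k (subst (1ℚ ≤_) z≡-k 1≤z)

≤-by-difference : ∀ {p q p' q' d} → 0ℚ ≤ d → q' - p' ≡ (q - p) + d → p ≤ q → p' ≤ q'
≤-by-difference {p} {q} {p'} {q'} {d} 0≤d eq p≤q =
  subst₂ _≤_ lhs rhs (+-monoˡ-≤ (p' - p) (+-mono-≤ p≤q 0≤d))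
  where
  open ≡-Reasoning
  lhs : p + 0ℚ + (p' - p) ≡ p'
  lhs = solve 2 (λ p p' → p :+ con 0ℚ :+ (p' :- p) := p') refl p p'
  rhs : q + d + (p' - p) ≡ q'
  rhs = begin
    q + d + (p' - p)  ≡⟨ solve 4 (λ p q p' d → q :+ d :+ (p' :- p) := (q :- p :+ d) :+ p') refl p q p' d ⟩
    (q - p + d) + p'  ≡⟨ cong (_+ p') eq ⟨
    q' - p' + p'      ≡⟨ solve 2 (λ p' q' → q' :- p' :+ p' := q') refl p' q' ⟩
    q'                ∎

p≤q⇒0≤q-p : ∀ {p q} → p ≤ q → 0ℚ ≤ q - p
p≤q⇒0≤q-p {p} {q} = ≤-by-difference ≤-refl (solve 2 (λ p q → q :- p :- con 0ℚ := q :- p :+ con 0ℚ) refl p q)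

half-sum+half-distance≡⊔ : ∀ p q → ½ * (p + q) + ½ * ∣ p - q ∣ ≡ p ⊔ q
half-sum+half-distance≡⊔ p q with ≤-total p q
... | inj₁ p≤q = begin
  ½ * (p + q) + ½ * ∣ p - q ∣
    ≡⟨ cong (λ t → ½ * (p + q) + ½ * ∣ t ∣) (solve 2 (λ p q → p :- q := :- (q :- p)) refl p q) ⟩
  ½ * (p + q) + ½ * ∣ - (q - p) ∣
    ≡⟨ cong (λ t → ½ * (p + q) + ½ * t) (trans (∣-p∣≡∣p∣ (q - p)) (0≤p⇒∣p∣≡p (p≤q⇒0≤q-p p≤q))) ⟩
  ½ * (p + q) + ½ * (q - p)
    ≡⟨ solve 2 (λ p q → con ½ :* (p :+ q) :+ con ½ :* (q :- p) := q) refl p q ⟩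
  q
    ≡⟨ p≤q⇒p⊔q≡q p≤q ⟨
  p ⊔ q
    ∎
  where open ≡-Reasoning
... | inj₂ q≤p = begin
  ½ * (p + q) + ½ * ∣ p - q ∣
    ≡⟨ cong (λ t → ½ * (p + q) + ½ * t) (0≤p⇒∣p∣≡p (p≤q⇒0≤q-p q≤p)) ⟩
  ½ * (p + q) + ½ * (p - q)
    ≡⟨ solve 2 (λ p q → con ½ :* (p :+ q) :+ con ½ :* (p :- q) := p) refl p q ⟩
  p
    ≡⟨ p≥q⇒p⊔q≡p q≤p ⟨
  p ⊔ q
    ∎
  where open ≡-Reasoning

gammaArgument≡⊔ : ∀ s p q → s + ½ * (p + q) + ½ * ∣ p - q ∣ ≡ (s + p) ⊔ (s + q)
gammaArgument≡⊔ s p q = begin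
  s + ½ * (p + q) + ½ * ∣ p - q ∣    ≡⟨ +-assoc s _ _ ⟩
  s + (½ * (p + q) + ½ * ∣ p - q ∣)  ≡⟨ cong (λ t → s + t) (half-sum+half-distance≡⊔ p q) ⟩
  s + (p ⊔ q)                        ≡⟨ mono-≤-distrib-⊔ (+-monoʳ-≤ s) p q ⟩
  (s + p) ⊔ (s + q)                  ∎
  where open ≡-Reasoning

lFinite⇔ : ∀ {s p q} → Integral (s + p) → Integral (s + q) →
           LFinite s p q ⇔ (1ℚ ≤ s + ½ * (p + q) + ½ * ∣ p - q ∣)
lFinite⇔ {s} {p} {q} ip iq = gammaFinite⇔ (subst Integral (sym (gammaArgument≡⊔ s p q)) (integral-⊔ ip iq))

∀-minFin⇔ : ∀ {k} {P : ℚ → Set} → P Respects _≤_ → (f : Fin (suc k) → ℚ) →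
            (∀ i → P (f i)) ⇔ P (minFin f)
∀-minFin⇔ {ℕ.zero} resp f = mk⇔ (λ h → h zero) (λ { h zero → h })
∀-minFin⇔ {suc k} {P} resp f = mk⇔ to from
  where
  tail⇔ : (∀ i → P (f (suc i))) ⇔ P (minFin (λ i → f (suc i)))
  tail⇔ = ∀-minFin⇔ resp (λ i → f (suc i))
  to : (∀ i → P (f i)) → P (minFin f)
  to h with ⊓-sel (f zero) (minFin (λ i → f (suc i)))
  ... | inj₁ ⊓≡head = subst P (sym ⊓≡head) (h zero)
  ... | inj₂ ⊓≡tail = subst P (sym ⊓≡tail) (Equivalence.to tail⇔ (λ i → h (suc i)))
  from : P (minFin f) → ∀ i → P (f i)
  from h zero    = resp (p⊓q≤p (f zero) _) h
  from h (suc i) = Equivalence.from tail⇔ (resp (p⊓q≤q (f zero) _) h) i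

∀³-minFin⇔ : ∀ {a b c} {P : ℚ → Set} → P Respects _≤_ →
             (f : Fin (suc a) → Fin (suc b) → Fin (suc c) → ℚ) →
             (∀ v i j → P (f v i j)) ⇔ P (minFin λ v → minFin λ i → minFin λ j → f v i j)
∀³-minFin⇔ {P = P} resp f = mk⇔
  (λ h → to (min⇔ _) (λ v → to (min⇔ _) (λ i → to (min⇔ _) (h v i))))
  (λ h v i j → from (min⇔ _) (from (min⇔ _) (from (min⇔ _) h v) i) j)
  where
  open Equivalence
  min⇔ : ∀ {k} (g : Fin (suc k) → ℚ) → (∀ i → P (g i)) ⇔ P (minFin g)
  min⇔ = ∀-minFin⇔ resp

∀³-cong : ∀ {A B C : Set} {P Q : A → B → C → Set} →
          (∀ v i j → P v i j ⇔ Q v i j) → (∀ v i j → P v i j) ⇔ (∀ v i j → Q v i j)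
∀³-cong e = mk⇔ (λ h v i j → Equivalence.to (e v i j) (h v i j))
                (λ h v i j → Equivalence.from (e v i j) (h v i j))

shift≡ : ∀ n (k : Fin n) → shift n k ≡ ½ * ℕ→ℚ n - ½ - ℕ→ℚ (toℕ k)
shift≡ n k = begin
  ½ * (ℕ→ℚ n - ℕ→ℚ 2 * ℕ→ℚ (suc (toℕ k)) + 1ℚ)
    ≡⟨ cong (λ t → ½ * (ℕ→ℚ n - ℕ→ℚ 2 * t + 1ℚ)) (ℕ→ℚ-+ 1 (toℕ k)) ⟩
  ½ * (ℕ→ℚ n - ℕ→ℚ 2 * (1ℚ + ℕ→ℚ (toℕ k)) + 1ℚ)
    ≡⟨ solve 2 (λ N K → con ½ :* (N :- con (ℕ→ℚ 2) :* (con 1ℚ :+ K) :+ con 1ℚ) := con ½ :* N :- con ½ :- K)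
               refl (ℕ→ℚ n) (ℕ→ℚ (toℕ k)) ⟩
  ½ * ℕ→ℚ n - ½ - ℕ→ℚ (toℕ k)
    ∎
  where open ≡-Reasoning

α-difference : ∀ {r n n'} (b : Weight r n) (b' : Weight r n') v i j →
  - (½ * ℕ→ℚ (n ℕ.+ n')) + (α b v i - α b' v j)
  ≡ ((ℤ→ℚ (b' v true (opposite j)) - ℤ→ℚ (b v true (opposite i))) + (ℕ→ℚ (toℕ j) - ℕ→ℚ (toℕ i))) - ℕ→ℚ n'
α-difference {n = n} {n'} b b' v i j =
  regroup (ℕ→ℚ n) (ℕ→ℚ n') (ℕ→ℚ (toℕ i)) (ℕ→ℚ (toℕ j))
          (ℤ→ℚ (b v true (opposite i))) (ℤ→ℚ (b' v true (opposite j)))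
          (ℕ→ℚ-+ n n') (shift≡ n i) (shift≡ n' j)
  where
  -- Matching refl keeps the solver's equation over variables; normalising it on concrete weights blows up.
  regroup : ∀ {M S S'} N N' I J B B' → M ≡ N + N' → S ≡ ½ * N - ½ - I → S' ≡ ½ * N' - ½ - J →
            - (½ * M) + ((- B + S) - (- B' + S')) ≡ ((B' - B) + (J - I)) - N'
  regroup N N' I J B B' refl refl refl = solve 6 (λ N N' I J B B' →
    :- (con ½ :* (N :+ N')) :+ ((:- B :+ (con ½ :* N :- con ½ :- I)) :- (:- B' :+ (con ½ :* N' :- con ½ :- J)))
    := ((B' :- B) :+ (J :- I)) :- N') refl N N' I J B B'

β-difference : ∀ {r n n'} (b : Weight r n) (b' : Weight r n') v i j →
  - (½ * ℕ→ℚ (n ℕ.+ n')) + (β b v i - β b' v j)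
  ≡ ((ℤ→ℚ (b' v false j) - ℤ→ℚ (b v false i)) + (ℕ→ℚ (toℕ i) - ℕ→ℚ (toℕ j))) - ℕ→ℚ n
β-difference {n = n} {n'} b b' v i j =
  regroup (ℕ→ℚ n) (ℕ→ℚ n') (ℕ→ℚ (toℕ i)) (ℕ→ℚ (toℕ j)) (ℤ→ℚ (b v false i)) (ℤ→ℚ (b' v false j))
          (ℕ→ℚ-+ n n') (shift≡ n i) (shift≡ n' j)
  where
  regroup : ∀ {M S S'} N N' I J B̄ B̄' → M ≡ N + N' → S ≡ ½ * N - ½ - I → S' ≡ ½ * N' - ½ - J →
            - (½ * M) + ((- B̄ - S) - (- B̄' - S')) ≡ ((B̄' - B̄) + (I - J)) - N
  regroup N N' I J B̄ B̄' refl refl refl = solve 6 (λ N N' I J B̄ B̄' →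
    :- (con ½ :* (N :+ N')) :+ ((:- B̄ :- (con ½ :* N :- con ½ :- I)) :- (:- B̄' :- (con ½ :* N' :- con ½ :- J)))
    := ((B̄' :- B̄) :+ (I :- J)) :- N) refl N N' I J B̄ B̄'

module _ {r n n'} (b : Weight r n) (b' : Weight r n') where

  IntegralAt : ℚ → Set
  IntegralAt s = ∀ v i j → Integral (s + (α b v i - α b' v j)) × Integral (s + (β b v i - β b' v j))

  integralAt-minus-½N : IntegralAt (- (½ * ℕ→ℚ (n ℕ.+ n')))
  integralAt-minus-½N v i j =
    subst Integral (sym (α-difference b b' v i j))
      (integral-- (integral-+ (integral-- (ℤ→ℚ-integral (b' v true (opposite j))) (ℤ→ℚ-integral (b v true (opposite i))))
                              (integral-- (ℕ→ℚ-integral (toℕ j)) (ℕ→ℚ-integral (toℕ i))))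
                  (ℕ→ℚ-integral n')) ,
    subst Integral (sym (β-difference b b' v i j))
      (integral-- (integral-+ (integral-- (ℤ→ℚ-integral (b' v false j)) (ℤ→ℚ-integral (b v false i)))
                              (integral-- (ℕ→ℚ-integral (toℕ i)) (ℕ→ℚ-integral (toℕ j))))
                  (ℕ→ℚ-integral n))

  integralAt-1+ : ∀ s → IntegralAt s → IntegralAt (1ℚ + s)
  integralAt-1+ s int v i j =
    shifted (α b v i - α b' v j) (proj₁ (int v i j)) , shifted (β b v i - β b' v j) (proj₂ (int v i j))
    where
    shifted : ∀ p → Integral (s + p) → Integral (1ℚ + s + p)
    shifted p = subst Integral (sym (+-assoc 1ℚ s p)) ∘ integral-+ (ℤ→ℚ-integral (+ 1))

β≡-w-α : ∀ {r n} (b : Weight r n) w → Pure b w → ∀ v i → β b v i ≡ - ℤ→ℚ w - α b v i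
β≡-w-α {n = n} b w pure v i = begin
  - ℤ→ℚ (b v false i) - shift n i
    ≡⟨ regroup (ℤ→ℚ (b v true (opposite i))) (ℤ→ℚ (b v false i)) (shift n i) ⟩
  - (ℤ→ℚ (b v true (opposite i)) + ℤ→ℚ (b v false i)) - α b v i
    ≡⟨ cong (λ t → - t - α b v i) (ℤ→ℚ-+ (b v true (opposite i)) (b v false i)) ⟨
  - ℤ→ℚ (b v true (opposite i) ℤ.+ b v false i) - α b v i
    ≡⟨ cong (λ t → - ℤ→ℚ t - α b v i) purity ⟩
  - ℤ→ℚ w - α b v i
    ∎
  where
  open ≡-Reasoning
  regroup : ∀ B B̄ S → - B̄ - S ≡ - (B + B̄) - (- B + S)
  regroup = solve 3 (λ B B̄ S → :- B̄ :- S := :- (B :+ B̄) :- (:- B :+ S)) refl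
  purity : b v true (opposite i) ℤ.+ b v false i ≡ w
  purity = subst (λ k → b v true (opposite i) ℤ.+ b v false k ≡ w) (opposite-involutive i) (pure v true (opposite i))

half-sum-of-differences : ∀ a a' c c' W W' → c ≡ - W - a → c' ≡ - W' - a' →
                          ½ * ((a - a') + (c - c')) ≡ - (½ * (W - W'))
half-sum-of-differences a a' _ _ W W' refl refl = solve 4 (λ a a' W W' →
  con ½ :* ((a :- a') :+ ((:- W :- a) :- (:- W' :- a'))) := :- (con ½ :* (W :- W'))) refl a a' W W'

half-sum-of-opposites : ∀ a a' c c' W W' → c ≡ - W - a → c' ≡ - W' - a' →
                        ½ * ((- a + a') + (- c + c')) ≡ ½ * (W - W')
half-sum-of-opposites a a' _ _ W W' refl refl = solve 4 (λ a a' W W' →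
  con ½ :* ((:- a :+ a') :+ (:- (:- W :- a) :+ (:- W' :- a'))) := con ½ :* (W :- W')) refl a a' W W'

distance-of-differences : ∀ a a' c c' → ∣ (a - a') - (c - c') ∣ ≡ ∣ a - a' - c + c' ∣
distance-of-differences a a' c c' = cong ∣_∣ (solve 4 (λ a a' c c' →
  (a :- a') :- (c :- c') := a :- a' :- c :+ c') refl a a' c c')

distance-of-opposites : ∀ a a' c c' → ∣ (- a + a') - (- c + c') ∣ ≡ ∣ a - a' - c + c' ∣
distance-of-opposites a a' c c' = trans (cong ∣_∣ (solve 4 (λ a a' c c' →
  (:- a :+ a') :- (:- c :+ c') := :- (a :- a' :- c :+ c')) refl a a' c c')) (∣-p∣≡∣p∣ _)

module _ {r n n'} (b : Weight (suc r) (suc n)) (b' : Weight (suc r) (suc n')) (w w' : ℤ)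
         (pure : Pure b w) (pure' : Pure b' w') where

  private
    A L : ℚ
    A = abelianWidth w w'
    L = cuspidalWidth b b'

    D : Fin (suc r) → Fin (suc n) → Fin (suc n') → ℚ
    D v i j = ∣ α b v i - α b' v j - β b v i + β b' v j ∣

  first-factor⇔ : ∀ s → IntegralAt b b' s → ∀ v i j →
    LFinite s (α b v i - α b' v j) (β b v i - β b' v j) ⇔ (1ℚ ≤ s - A + ½ * D v i j)
  first-factor⇔ s int v i j =
    subst (λ x → LFinite s p q ⇔ (1ℚ ≤ x)) argument
      (lFinite⇔ {s} {p} {q} (proj₁ (int v i j)) (proj₂ (int v i j)))
    where
    p q : ℚ
    p = α b v i - α b' v j
    q = β b v i - β b' v j
    half-sum : ½ * (p + q) ≡ - A
    half-sum = half-sum-of-differences (α b v i) (α b' v j) (β b v i) (β b' v j) (ℤ→ℚ w) (ℤ→ℚ w')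
                 (β≡-w-α b w pure v i) (β≡-w-α b' w' pure' v j)
    argument : s + ½ * (p + q) + ½ * ∣ p - q ∣ ≡ s - A + ½ * D v i j
    argument = cong₂ (λ x y → s + x + ½ * y) half-sum
                 (distance-of-differences (α b v i) (α b' v j) (β b v i) (β b' v j))

  second-factor⇔ : ∀ s → IntegralAt b b' s → ∀ v i j →
    LFinite (1ℚ - s) (- α b v i + α b' v j) (- β b v i + β b' v j) ⇔ (1ℚ ≤ (1ℚ - s) + A + ½ * D v i j)
  second-factor⇔ s int v i j =
    subst (λ x → LFinite (1ℚ - s) p q ⇔ (1ℚ ≤ x)) argument
      (lFinite⇔ {1ℚ - s} {p} {q} (reflected (α b v i) (α b' v j) (proj₁ (int v i j)))
                                  (reflected (β b v i) (β b' v j) (proj₂ (int v i j))))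
    where
    p q : ℚ
    p = - α b v i + α b' v j
    q = - β b v i + β b' v j
    reflected : ∀ x x' → Integral (s + (x - x')) → Integral ((1ℚ - s) + (- x + x'))
    reflected x x' = subst Integral (sym (reflection s x x')) ∘ integral-- (ℤ→ℚ-integral (+ 1))
      where
      reflection : ∀ s x x' → (1ℚ - s) + (- x + x') ≡ 1ℚ - (s + (x - x'))
      reflection = solve 3 (λ s x x' → (con 1ℚ :- s) :+ (:- x :+ x') := con 1ℚ :- (s :+ (x :- x'))) refl
    half-sum : ½ * (p + q) ≡ A
    half-sum = half-sum-of-opposites (α b v i) (α b' v j) (β b v i) (β b' v j) (ℤ→ℚ w) (ℤ→ℚ w')
                 (β≡-w-α b w pure v i) (β≡-w-α b' w' pure' v j)
    argument : (1ℚ - s) + ½ * (p + q) + ½ * ∣ p - q ∣ ≡ (1ℚ - s) + A + ½ * D v i j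
    argument = cong₂ (λ x y → (1ℚ - s) + x + ½ * y) half-sum
                 (distance-of-opposites (α b v i) (α b' v j) (β b v i) (β b' v j))

  bound⇔ : ∀ x → (∀ v i j → 1ℚ ≤ x + ½ * D v i j) ⇔ (1ℚ ≤ x + ½ * L)
  bound⇔ x = ∀³-minFin⇔ {P = λ d → 1ℚ ≤ x + ½ * d}
    (λ d≤d' 1≤x+½d → ≤-trans 1≤x+½d (+-monoʳ-≤ x (*-monoˡ-≤-nonNeg ½ d≤d'))) D

  critical⇔ : ∀ s → IntegralAt b b' s →
    Critical b b' s ⇔ ((1ℚ ≤ s - A + ½ * L) × (1ℚ ≤ (1ℚ - s) + A + ½ * L))
  critical⇔ s int = (bound⇔ (s - A) ⇔-∘ ∀³-cong (first-factor⇔ s int))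
                  ×-⇔ (bound⇔ ((1ℚ - s) + A) ⇔-∘ ∀³-cong (second-factor⇔ s int))

window⇔ : ∀ s A L →
  (((1ℚ ≤ s - A + ½ * L) × (1ℚ ≤ (1ℚ - s) + A + ½ * L)) ×
   ((1ℚ ≤ (1ℚ + s) - A + ½ * L) × (1ℚ ≤ (1ℚ - (1ℚ + s)) + A + ½ * L)))
  ⇔ ((s + 1ℚ - ½ * L ≤ A) × (A ≤ s - 1ℚ + ½ * L))
window⇔ s A L = mk⇔
  (λ ((first₀ , _) , (_ , second₁)) → second₁⇒lower second₁ , first₀⇒upper first₀)
  (λ (lower , upper) → (upper⇒first₀ upper , lower⇒second₀ lower) , (upper⇒first₁ upper , lower⇒second₁ lower))
  where
  first₀⇒upper : 1ℚ ≤ s - A + ½ * L → A ≤ s - 1ℚ + ½ * L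
  first₀⇒upper = ≤-by-difference ≤-refl (solve 3 (λ s A L →
    (s :- con 1ℚ :+ con ½ :* L) :- A := (s :- A :+ con ½ :* L :- con 1ℚ) :+ con 0ℚ) refl s A L)
  second₁⇒lower : 1ℚ ≤ (1ℚ - (1ℚ + s)) + A + ½ * L → s + 1ℚ - ½ * L ≤ A
  second₁⇒lower = ≤-by-difference ≤-refl (solve 3 (λ s A L →
    A :- (s :+ con 1ℚ :- con ½ :* L) := ((con 1ℚ :- (con 1ℚ :+ s)) :+ A :+ con ½ :* L :- con 1ℚ) :+ con 0ℚ) refl s A L)
  upper⇒first₀ : A ≤ s - 1ℚ + ½ * L → 1ℚ ≤ s - A + ½ * L
  upper⇒first₀ = ≤-by-difference ≤-refl (solve 3 (λ s A L →
    s :- A :+ con ½ :* L :- con 1ℚ := ((s :- con 1ℚ :+ con ½ :* L) :- A) :+ con 0ℚ) refl s A L)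
  upper⇒first₁ : A ≤ s - 1ℚ + ½ * L → 1ℚ ≤ (1ℚ + s) - A + ½ * L
  upper⇒first₁ = ≤-by-difference (nonNegative⁻¹ 1ℚ) (solve 3 (λ s A L →
    (con 1ℚ :+ s) :- A :+ con ½ :* L :- con 1ℚ := ((s :- con 1ℚ :+ con ½ :* L) :- A) :+ con 1ℚ) refl s A L)
  lower⇒second₁ : s + 1ℚ - ½ * L ≤ A → 1ℚ ≤ (1ℚ - (1ℚ + s)) + A + ½ * L
  lower⇒second₁ = ≤-by-difference ≤-refl (solve 3 (λ s A L →
    (con 1ℚ :- (con 1ℚ :+ s)) :+ A :+ con ½ :* L :- con 1ℚ := (A :- (s :+ con 1ℚ :- con ½ :* L)) :+ con 0ℚ) refl s A L)
  lower⇒second₀ : s + 1ℚ - ½ * L ≤ A → 1ℚ ≤ (1ℚ - s) + A + ½ * L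
  lower⇒second₀ = ≤-by-difference (nonNegative⁻¹ 1ℚ) (solve 3 (λ s A L →
    (con 1ℚ :- s) :+ A :+ con ½ :* L :- con 1ℚ := (A :- (s :+ con 1ℚ :- con ½ :* L)) :+ con 1ℚ) refl s A L)

corollary3p2 : (r n₀ n₀' : ℕ)
    (b : Weight (suc r) (suc n₀)) (b' : Weight (suc r) (suc n₀')) (w w' : ℤ)
    → Dominant b → Dominant b' → Pure b w → Pure b' w'
    → (Critical b b' (- (½ * ℕ→ℚ (suc n₀ ℕ.+ suc n₀')))
        × Critical b b' (1ℚ - ½ * ℕ→ℚ (suc n₀ ℕ.+ suc n₀')))
      ⇔ ((- (½ * ℕ→ℚ (suc n₀ ℕ.+ suc n₀')) + 1ℚ - ½ * cuspidalWidth b b' ≤ abelianWidth w w')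
        × (abelianWidth w w' ≤ - (½ * ℕ→ℚ (suc n₀ ℕ.+ suc n₀')) - 1ℚ + ½ * cuspidalWidth b b'))
corollary3p2 r n₀ n₀' b b' w w' _ _ pure pure' =
  window⇔ s (abelianWidth w w') (cuspidalWidth b b')
    ⇔-∘ (critical⇔ b b' w w' pure pure' s s-integral
         ×-⇔ critical⇔ b b' w w' pure pure' (1ℚ + s) (integralAt-1+ b b' s s-integral))
  where
  s : ℚ
  s = - (½ * ℕ→ℚ (suc n₀ ℕ.+ suc n₀'))
  s-integral : IntegralAt b b' s
  s-integral = integralAt-minus-½N b b'
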